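{- Let $n$ be a power of two, and let $\Omega_n$ be the graph whose vertices are all $\pm1$-vectors of length $n$, two vertices being adjacent if and only if they are orthogonal. Then \[ \alpha(\Omega_n)\leq\frac{2^n}{n}, \] and if equality holds then $\chi(\Omega_n)=n$.
   Context: $\alpha$ is the independence number and $\chi$ the chromatic number. -}

module Defs where

open import Data.Nat using (ℕ; _*_; _^_; _<_; _≤_)
open import Data.Bool using (Bool; true; false)
open import Data.Vec using (Vec; zipWith; foldr)
open import Data.Integer as ℤ using (ℤ; +_; -[1+_])
open import Data.Fin using (Fin)
open import Data.List using (List; length)
open import Data.List.Relation.Unary.Unique.Propositional using (Unique)
open import Data.List.Membership.Propositional using (_∈_)
open import Data.Product using (Σ; _×_)
open import Relation.Binary.PropositionalEquality using (_≡_)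
open import Relation.Nullary using (¬_)

-- A ±1-vector of length n: true encodes +1, false encodes -1.
PMVec : ℕ → Set
PMVec n = Vec Bool n

val : Bool → ℤ
val true  = + 1
val false = -[1+ 0 ]

inner : ∀ {n} → PMVec n → PMVec n → ℤ
inner u v = foldr _ ℤ._+_ (+ 0) (zipWith (λ a b → val a ℤ.* val b) u v)

Adj : ∀ {n} → PMVec n → PMVec n → Set
Adj u v = inner u v ≡ + 0

IsPowerOfTwo : ℕ → Set
IsPowerOfTwo n = Σ ℕ (λ k → n ≡ 2 ^ k)

IsIndependent : ∀ {n} → List (PMVec n) → Set
IsIndependent {n} S =
  Unique S × (∀ {u v : PMVec n} → u ∈ S → v ∈ S → ¬ Adj u v)

IsProperColouring : ∀ {n} k → (PMVec n → Fin k) → Set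
IsProperColouring {n} k c = ∀ (u v : PMVec n) → Adj u v → ¬ (c u ≡ c v)

ChromaticNumberIs : ℕ → ℕ → Set
ChromaticNumberIs n k =
  Σ (PMVec n → Fin k) (IsProperColouring k)
  × (∀ j → j < k → ¬ Σ (PMVec n → Fin j) (IsProperColouring j))

-- α(Ω_n) ≤ 2^n / n, stated multiplicatively: every independent set S has n·|S| ≤ 2^n.
-- α(Ω_n) = 2^n / n: some independent set S has n·|S| = 2^n.

-- The 2^k rows of the Sylvester–Hadamard matrix H = H₂ ⊗ ⋯ ⊗ H₂ are pairwise
-- orthogonal ±1-vectors of length n = 2^k. Pointwise multiplication by a fixed
-- ±1-vector preserves inner products, so the n translates S ⊙ Hᵢ of an
-- independent set S are pairwise disjoint: a common point s ⊙ Hᵢ = s' ⊙ Hⱼ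
-- would give ⟨s, s'⟩ = ⟨Hᵢ, Hⱼ⟩ = 0. Hence n |S| ≤ 2^n. At equality the
-- translates cover every vertex, and colouring x by the i with x ⊙ Hᵢ ∈ S is
-- proper, since each colour class is a translate of S; the rows of H form an
-- n-clique, so no colouring uses fewer than n colours.
module Submission where

open import Defs
open import Data.Nat using (ℕ; _*_; _^_; _≤_)
open import Data.List using (List; length)
open import Data.Product using (Σ; _×_)
open import Relation.Binary.PropositionalEquality using (_≡_)

open import Data.Bool using (Bool; true; false; not)
open import Data.Fin using (Fin; zero; suc; combine; remQuot)
open import Data.Fin.Properties
  using (_≟_; any?; injective⇒≤; combine-injective; *↔×; 2↔Bool)
open import Data.Integer as ℤ using (+_)
import Data.Integer.Properties as ℤP
open import Algebra.Properties.CommutativeSemigroup ℤP.*-commutativeSemigroup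
  using (interchange)
import Data.List as List
open import Data.List.Membership.Propositional using (_∈_)
open import Data.List.Membership.Propositional.Properties using (∈-lookup)
import Data.List.Relation.Unary.All as All
open import Data.List.Relation.Unary.AllPairs using (_∷_)
open import Data.List.Relation.Unary.Unique.Propositional using (Unique)
import Data.Nat as ℕ
open import Data.Nat.Properties using (≤⇒≯; <⇒≱; ≤-reflexive)
open import Data.Product using (_,_; proj₁; proj₂; ∃)
open import Data.Vec as Vec using ([]; _∷_; _++_; zipWith)
open import Function using (_∘_)
open import Function.Bundles using (Injection; Inverse)
open import Function.Definitions using (Injective)
open import Function.Properties.Inverse using (↔⇒↣; ↔-sym)
open import Relation.Binary.PropositionalEquality
  using (refl; sym; trans; cong; cong₂; subst; _≢_; module ≡-Reasoning)
open import Relation.Nullary using (yes; no; contradiction)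

private
  variable
    m n p : ℕ
    I J : Set

remQuot-injective : ∀ n → Injective _≡_ _≡_ (remQuot {m} n)
remQuot-injective n = Injection.injective (↔⇒↣ *↔×)

injective⇒surjective : {f : Fin m → Fin n} →
  Injective _≡_ _≡_ f → n ≤ m → ∀ y → ∃ λ x → f x ≡ y
injective⇒surjective {m} {n} {f} f-inj n≤m y with any? (λ x → f x ≟ y)
... | yes hit = hit
... | no miss = contradiction (injective⇒≤ g-inj) (≤⇒≯ n≤m)
  where
  g : Fin (ℕ.suc m) → Fin n
  g zero    = y
  g (suc x) = f x
  g-inj : Injective _≡_ _≡_ g
  g-inj {zero}  {zero}   _ = refl
  g-inj {zero}  {suc x'} e = contradiction (x' , sym e) miss
  g-inj {suc x} {zero}   e = contradiction (x , e) miss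
  g-inj {suc x} {suc x'} e = cong suc (f-inj e)

Unique⇒lookup-injective : {A : Set} {xs : List A} →
  Unique xs → Injective _≡_ _≡_ (List.lookup xs)
Unique⇒lookup-injective (x∉xs ∷ u) {zero}  {zero}  _ = refl
Unique⇒lookup-injective (x∉xs ∷ u) {zero}  {suc j} e =
  contradiction e (All.lookup x∉xs (∈-lookup j))
Unique⇒lookup-injective (x∉xs ∷ u) {suc i} {zero}  e =
  contradiction (sym e) (All.lookup x∉xs (∈-lookup i))
Unique⇒lookup-injective (x∉xs ∷ u) {suc i} {suc j} e =
  cong suc (Unique⇒lookup-injective u e)

xnor : Bool → Bool → Bool
xnor true  b = b
xnor false b = not b

xnor-comm : ∀ a b → xnor a b ≡ xnor b a
xnor-comm true  true  = refl
xnor-comm true  false = refl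
xnor-comm false true  = refl
xnor-comm false false = refl

xnor-selfInverse : ∀ a b → xnor (xnor a b) b ≡ a
xnor-selfInverse true  true  = refl
xnor-selfInverse true  false = refl
xnor-selfInverse false true  = refl
xnor-selfInverse false false = refl

val-xnor : ∀ a b → val (xnor a b) ≡ val a ℤ.* val b
val-xnor true  true  = refl
val-xnor true  false = refl
val-xnor false true  = refl
val-xnor false false = refl

val-square : ∀ a → val a ℤ.* val a ≡ + 1
val-square true  = refl
val-square false = refl

val-xnor-xnor : ∀ a b c d →
  val (xnor a c) ℤ.* val (xnor b d) ≡ (val a ℤ.* val b) ℤ.* (val c ℤ.* val d)
val-xnor-xnor a b c d =
  trans (cong₂ ℤ._*_ (val-xnor a c) (val-xnor b d))
        (interchange (val a) (val c) (val b) (val d))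

infixl 7 _⊙_

_⊙_ : PMVec n → PMVec n → PMVec n
_⊙_ = zipWith xnor

⊙-comm : (u v : PMVec n) → u ⊙ v ≡ v ⊙ u
⊙-comm []      []      = refl
⊙-comm (a ∷ u) (b ∷ v) = cong₂ _∷_ (xnor-comm a b) (⊙-comm u v)

⊙-selfInverse : (u x : PMVec n) → u ⊙ x ⊙ x ≡ u
⊙-selfInverse []      []      = refl
⊙-selfInverse (a ∷ u) (b ∷ x) = cong₂ _∷_ (xnor-selfInverse a b) (⊙-selfInverse u x)

⊙-cancelʳ : {u v x : PMVec n} → u ⊙ x ≡ v ⊙ x → u ≡ v
⊙-cancelʳ {u = u} {v} {x} e =
  trans (sym (⊙-selfInverse u x)) (trans (cong (_⊙ x) e) (⊙-selfInverse v x))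

inner-⊙ʳ : (u v x : PMVec n) → inner (u ⊙ x) (v ⊙ x) ≡ inner u v
inner-⊙ʳ []      []      []      = refl
inner-⊙ʳ (a ∷ u) (b ∷ v) (c ∷ x) = cong₂ ℤ._+_ entry (inner-⊙ʳ u v x)
  where
  open ≡-Reasoning
  entry : val (xnor a c) ℤ.* val (xnor b c) ≡ val a ℤ.* val b
  entry = begin
    val (xnor a c) ℤ.* val (xnor b c)       ≡⟨ val-xnor-xnor a b c c ⟩
    (val a ℤ.* val b) ℤ.* (val c ℤ.* val c) ≡⟨ cong ((val a ℤ.* val b) ℤ.*_) (val-square c) ⟩
    (val a ℤ.* val b) ℤ.* + 1               ≡⟨ ℤP.*-identityʳ _ ⟩
    val a ℤ.* val b                         ∎

⊙-≡⇒inner-≡ : {s s' h h' : PMVec n} → s ⊙ h ≡ s' ⊙ h' → inner s s' ≡ inner h h'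
⊙-≡⇒inner-≡ {s = s} {s'} {h} {h'} e = begin
  inner s s'                         ≡⟨ sym (cong₂ inner (⊙-selfInverse s h) (⊙-selfInverse s' h')) ⟩
  inner (s ⊙ h ⊙ h) (s' ⊙ h' ⊙ h')   ≡⟨ cong (λ y → inner (y ⊙ h) (s' ⊙ h' ⊙ h')) e ⟩
  inner (y ⊙ h) (y ⊙ h')             ≡⟨ cong₂ inner (⊙-comm y h) (⊙-comm y h') ⟩
  inner (h ⊙ y) (h' ⊙ y)             ≡⟨ inner-⊙ʳ h h' y ⟩
  inner h h'                         ∎
  where
  open ≡-Reasoning
  y = s' ⊙ h'

inner-++ : (a c : PMVec m) (b d : PMVec n) →
  inner (a ++ b) (c ++ d) ≡ inner a c ℤ.+ inner b d
inner-++ []      []      b d = sym (ℤP.+-identityˡ (inner b d))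
inner-++ (x ∷ a) (y ∷ c) b d =
  trans (cong (ℤ._+_ (val x ℤ.* val y)) (inner-++ a c b d))
        (sym (ℤP.+-assoc (val x ℤ.* val y) (inner a c) (inner b d)))

inner-scale : (b c : Bool) (u v : PMVec n) →
  inner (Vec.map (xnor b) u) (Vec.map (xnor c) v) ≡ (val b ℤ.* val c) ℤ.* inner u v
inner-scale b c []      []      = sym (ℤP.*-zeroʳ (val b ℤ.* val c))
inner-scale b c (x ∷ u) (y ∷ v) =
  trans (cong₂ ℤ._+_ (val-xnor-xnor b c x y) (inner-scale b c u v))
        (sym (ℤP.*-distribˡ-+ (val b ℤ.* val c) (val x ℤ.* val y) (inner u v)))

infixr 7 _⊗_

_⊗_ : PMVec m → PMVec n → PMVec (m * n)
[]      ⊗ u = []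
(b ∷ a) ⊗ u = Vec.map (xnor b) u ++ a ⊗ u

inner-⊗ : (a b : PMVec m) (u v : PMVec n) →
  inner (a ⊗ u) (b ⊗ v) ≡ inner a b ℤ.* inner u v
inner-⊗ []      []      u v = refl
inner-⊗ (x ∷ a) (y ∷ b) u v = begin
  inner (Vec.map (xnor x) u ++ a ⊗ u) (Vec.map (xnor y) v ++ b ⊗ v)
    ≡⟨ inner-++ (Vec.map (xnor x) u) (Vec.map (xnor y) v) (a ⊗ u) (b ⊗ v) ⟩
  inner (Vec.map (xnor x) u) (Vec.map (xnor y) v) ℤ.+ inner (a ⊗ u) (b ⊗ v)
    ≡⟨ cong₂ ℤ._+_ (inner-scale x y u v) (inner-⊗ a b u v) ⟩
  (val x ℤ.* val y) ℤ.* inner u v ℤ.+ inner a b ℤ.* inner u v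
    ≡⟨ sym (ℤP.*-distribʳ-+ (inner u v) (val x ℤ.* val y) (inner a b)) ⟩
  (val x ℤ.* val y ℤ.+ inner a b) ℤ.* inner u v
    ∎
  where open ≡-Reasoning

record Orthogonal (H : I → PMVec n) : Set where
  field
    orthogonal : ∀ {i j} → i ≢ j → Adj (H i) (H j)

open Orthogonal public

orthogonal-∘ : {H : J → PMVec n} {f : I → J} →
  Orthogonal H → Injective _≡_ _≡_ f → Orthogonal (H ∘ f)
orthogonal-∘ H-orth f-inj .orthogonal i≢j = orthogonal H-orth (i≢j ∘ f-inj)

_⊗ᶠ_ : (I → PMVec m) → (J → PMVec n) → I × J → PMVec (m * n)
(H ⊗ᶠ K) (i , j) = H i ⊗ K j

⊗ᶠ-orthogonal : {H : Fin p → PMVec m} {K : J → PMVec n} →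
  Orthogonal H → Orthogonal K → Orthogonal (H ⊗ᶠ K)
⊗ᶠ-orthogonal {H = H} {K} H-orth K-orth .orthogonal {i , j} {i' , j'} ij≢i'j'
  with i ≟ i'
... | no i≢i' =
  trans (inner-⊗ (H i) (H i') (K j) (K j'))
        (cong (ℤ._* inner (K j) (K j')) (orthogonal H-orth i≢i'))
... | yes refl =
  trans (inner-⊗ (H i) (H i) (K j) (K j'))
        (trans (cong (inner (H i) (H i) ℤ.*_) (orthogonal K-orth (ij≢i'j' ∘ cong (i ,_))))
               (ℤP.*-zeroʳ (inner (H i) (H i))))

hadamard₂ : Fin 2 → PMVec 2
hadamard₂ zero       = true ∷ true ∷ []
hadamard₂ (suc zero) = true ∷ false ∷ []

hadamard₂-orthogonal : Orthogonal hadamard₂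
hadamard₂-orthogonal .orthogonal {zero}     {zero}     0≢0 = contradiction refl 0≢0
hadamard₂-orthogonal .orthogonal {zero}     {suc zero} _   = refl
hadamard₂-orthogonal .orthogonal {suc zero} {zero}     _   = refl
hadamard₂-orthogonal .orthogonal {suc zero} {suc zero} 1≢1 = contradiction refl 1≢1

hadamard : ∀ k → Fin (2 ^ k) → PMVec (2 ^ k)
hadamard ℕ.zero    _ = true ∷ []
hadamard (ℕ.suc k) = (hadamard₂ ⊗ᶠ hadamard k) ∘ remQuot (2 ^ k)

hadamard-orthogonal : ∀ k → Orthogonal (hadamard k)
hadamard-orthogonal ℕ.zero .orthogonal {zero} {zero} 0≢0 = contradiction refl 0≢0
hadamard-orthogonal (ℕ.suc k) =
  orthogonal-∘ (⊗ᶠ-orthogonal hadamard₂-orthogonal (hadamard-orthogonal k))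
    (remQuot-injective (2 ^ k))

encode : PMVec n → Fin (2 ^ n)
encode []      = zero
encode (b ∷ v) = combine (Inverse.from 2↔Bool b) (encode v)

encode-injective : Injective _≡_ _≡_ (encode {n})
encode-injective {x = []}    {[]}    _ = refl
encode-injective {x = a ∷ u} {b ∷ v} e =
  let a≡b , u≡v = combine-injective _ _ _ _ e
  in cong₂ _∷_ (Injection.injective (↔⇒↣ (↔-sym 2↔Bool)) a≡b) (encode-injective u≡v)

orthogonal⇒colours-≥ : {H : Fin m → PMVec n} {c : PMVec n → Fin p} →
  Orthogonal H → IsProperColouring p c → m ≤ p
orthogonal⇒colours-≥ {H = H} {c} H-orth c-proper = injective⇒≤ c∘H-injective
  where
  c∘H-injective : Injective _≡_ _≡_ (c ∘ H)
  c∘H-injective {i} {j} e with i ≟ j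
  ... | yes i≡j = i≡j
  ... | no i≢j  = contradiction e (c-proper (H i) (H j) (orthogonal H-orth i≢j))

module _ {H : Fin m → PMVec n} (H-orth : Orthogonal H)
         {S : List (PMVec n)} (S-indep : IsIndependent S) where

  translate : Fin m × Fin (length S) → PMVec n
  translate (i , a) = List.lookup S a ⊙ H i

  translate-injective : Injective _≡_ _≡_ translate
  translate-injective {i , a} {j , b} e with i ≟ j
  ... | no i≢j   = contradiction (trans (⊙-≡⇒inner-≡ e) (orthogonal H-orth i≢j))
                                 (proj₂ S-indep (∈-lookup a) (∈-lookup b))
  ... | yes refl = cong (i ,_) (Unique⇒lookup-injective (proj₁ S-indep) (⊙-cancelʳ e))

  encode-translate-injective :
    Injective _≡_ _≡_ (encode ∘ translate ∘ remQuot (length S))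
  encode-translate-injective =
    remQuot-injective (length S) ∘ translate-injective ∘ encode-injective

  independent-bound : m * length S ≤ 2 ^ n
  independent-bound = injective⇒≤ encode-translate-injective

  translates-cover : 2 ^ n ≤ m * length S → ∀ x → ∃ λ i → x ⊙ H i ∈ S
  translates-cover tight x =
    let t , hit = injective⇒surjective encode-translate-injective tight (encode x)
        i , a = remQuot (length S) t
        s = List.lookup S a
    in i , subst (λ y → y ⊙ H i ∈ S) (encode-injective hit)
                 (subst (_∈ S) (sym (⊙-selfInverse s (H i))) (∈-lookup a))

  translates-colouring : 2 ^ n ≤ m * length S → Σ (PMVec n → Fin m) (IsProperColouring m)
  translates-colouring tight = colour , colour-proper
    where
    colour : PMVec n → Fin m
    colour x = proj₁ (translates-cover tight x)
    colour-proper : IsProperColouring m colour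
    colour-proper u v u⊥v same =
      proj₂ S-indep (proj₂ (translates-cover tight u))
                    (subst (λ i → v ⊙ H i ∈ S) (sym same) (proj₂ (translates-cover tight v)))
                    (trans (inner-⊙ʳ u v (H (colour u))) u⊥v)

  tight⇒chromaticNumber : m * length S ≡ 2 ^ n → ChromaticNumberIs n m
  tight⇒chromaticNumber tight =
      translates-colouring (≤-reflexive (sym tight))
    , λ j j<m (c , c-proper) → <⇒≱ j<m (orthogonal⇒colours-≥ H-orth c-proper)

mainTheorem7 : (n : ℕ) → IsPowerOfTwo n →
    ((S : List (PMVec n)) → IsIndependent S → n * length S ≤ 2 ^ n)
    × (Σ (List (PMVec n)) (λ S → IsIndependent S × n * length S ≡ 2 ^ n) →
    ChromaticNumberIs n n)
mainTheorem7 .(2 ^ k) (k , refl) =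
    (λ S S-indep → independent-bound (hadamard-orthogonal k) S-indep)
  , (λ (S , S-indep , tight) → tight⇒chromaticNumber (hadamard-orthogonal k) S-indep tight)
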